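{- Let $\mathcal{B}$ be a non-trivial Boolean algebra, $n\ge1$, $\mathsf{b}$ a $\mathcal{B}$-valuation for $C_n$, and $\alpha,\beta$ formulas. If $\mathsf{b}(\neg\alpha)=\sim\mathsf{b}(\alpha)$ and $\mathsf{b}(\neg\beta)=\sim\mathsf{b}(\beta)$, then $\mathsf{b}(\neg(\alpha\#\beta))=\sim\mathsf{b}(\alpha\#\beta)$ for each $\#\in\{\wedge,\vee,\to\}$. Also, if $\mathsf{b}(\neg\alpha)=\sim\mathsf{b}(\alpha)$, then $\mathsf{b}(\neg\neg\alpha)=\sim\mathsf{b}(\neg\alpha)$.
   Context: $\Sigma$ is the signature with unary $\neg$ and binary $\wedge,\vee,\to$; formulas are built from countably many propositional variables. For a formula $\alpha$: $\alpha^0=\alpha$, $\alpha^{k+1}=\neg(\alpha^k\wedge\neg(\alpha^k))$; $\alpha^\circ=\alpha^1$; $\alpha^{(1)}=\alpha^1$, $\alpha^{(k+1)}=\alpha^{(k)}\wedge\alpha^{k+1}$. For a non-trivial Boolean algebra $\mathcal{B}$ (complement $\sim$, implication $a\to b=\sim a\vee b$), a $\mathcal{B}$-valuation for $C_n$ is a map $\mathsf{b}$ from formulas to $|\mathcal{B}|$ such that for all formulas $\alpha,\beta$: (V1) $\mathsf{b}(\alpha\#\beta)=\mathsf{b}(\alpha)\#\mathsf{b}(\beta)$ for $\#\in\{\wedge,\vee,\to\}$; (V2) $\sim\mathsf{b}(\alpha)\le\mathsf{b}(\neg\alpha)$; (V3) $\mathsf{b}(\neg\neg\alpha)\le\mathsf{b}(\alpha)$;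 (V4)$_n$ $\mathsf{b}(\alpha^n)=\sim(\mathsf{b}(\alpha^{n-1})\wedge\mathsf{b}(\neg(\alpha^{n-1})))$; (V5) $\mathsf{b}(\neg(\alpha^\circ))=\mathsf{b}(\alpha)\wedge\mathsf{b}(\neg\alpha)$; (V6)$_n$ $\mathsf{b}(\alpha^{(n)})\wedge\mathsf{b}(\beta^{(n)})\le\mathsf{b}((\alpha\#\beta)^{(n)})$ for $\#\in\{\wedge,\vee,\to\}$. -}

module Defs where

open import Level using (Level; _⊔_)
open import Data.Nat using (ℕ; zero; suc; _∸_)
open import Relation.Nullary renaming (¬_ to Not)
open import Algebra.Lattice.Bundles using (BooleanAlgebra)

data Formula : Set where
  var  : ℕ → Formula
  ¬'_  : Formula → Formula
  _∧'_ : Formula → Formula → Formula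
  _∨'_ : Formula → Formula → Formula
  _→'_ : Formula → Formula → Formula

infix  8 ¬'_
infixr 7 _∧'_
infixr 6 _∨'_
infixr 5 _→'_

_^_ : Formula → ℕ → Formula
α ^ zero  = α
α ^ suc k = ¬' ((α ^ k) ∧' ¬' (α ^ k))

_° : Formula → Formula
α ° = α ^ 1

-- α^(k) for k ≥ 1: α^(1) = α^1, α^(k+1) = α^(k) ∧ α^(k+1).
-- (The value at k = 0 is a junk value α^1; it is only used with k ≥ 1.)
_^⁽_⁾ : Formula → ℕ → Formula
α ^⁽ zero ⁾        = α ^ 1
α ^⁽ suc zero ⁾    = α ^ 1
α ^⁽ suc (suc k) ⁾ = (α ^⁽ suc k ⁾) ∧' (α ^ suc (suc k))

module _ {c ℓ : Level} (𝓑 : BooleanAlgebra c ℓ) where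
  open BooleanAlgebra 𝓑 renaming (¬_ to ∼_)

  _⇒_ : Carrier → Carrier → Carrier
  a ⇒ b = (∼ a) ∨ b

  _≤ᴮ_ : Carrier → Carrier → Set ℓ
  a ≤ᴮ b = (a ∧ b) ≈ a

  NonTrivial : Set ℓ
  NonTrivial = Not (⊤ ≈ ⊥)

  record Valuation (n : ℕ) : Set (c ⊔ ℓ) where
    field
      b    : Formula → Carrier
      V1∧  : ∀ α β → b (α ∧' β) ≈ (b α ∧ b β)
      V1∨  : ∀ α β → b (α ∨' β) ≈ (b α ∨ b β)
      V1→  : ∀ α β → b (α →' β) ≈ (b α ⇒ b β)
      V2   : ∀ α → (∼ b α) ≤ᴮ b (¬' α)
      V3   : ∀ α → b (¬' ¬' α) ≤ᴮ b α
      V4   : ∀ α → b (α ^ n) ≈ (∼ (b (α ^ (n ∸ 1)) ∧ b (¬' (α ^ (n ∸ 1)))))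
      V5   : ∀ α → b (¬' (α °)) ≈ (b α ∧ b (¬' α))
      V6∧  : ∀ α β → (b (α ^⁽ n ⁾) ∧ b (β ^⁽ n ⁾)) ≤ᴮ b ((α ∧' β) ^⁽ n ⁾)
      V6∨  : ∀ α β → (b (α ^⁽ n ⁾) ∧ b (β ^⁽ n ⁾)) ≤ᴮ b ((α ∨' β) ^⁽ n ⁾)
      V6→  : ∀ α β → (b (α ^⁽ n ⁾) ∧ b (β ^⁽ n ⁾)) ≤ᴮ b ((α →' β) ^⁽ n ⁾)

-- Call γ classical when b(¬γ) ≈ ∼ b(γ).  If γ is classical, V5 makes ¬(γ°) false, so V2 makes
-- γ° true and again classical; hence γ¹, γ², … and so γ⁽ⁿ⁾ are all true.  Conversely, if γ⁽ⁿ⁾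
-- is true then so are γ¹, …, γⁿ; V4 then makes γⁿ⁻¹ ∧ ¬γⁿ⁻¹ false, V5 pushes this disjointness
-- down through the true γᵏ to γ ∧ ¬γ, and together with V2 that forces b(¬γ) ≈ ∼ b(γ).
-- For a connective #, V6 turns truth of α⁽ⁿ⁾ and β⁽ⁿ⁾ into truth of (α # β)⁽ⁿ⁾.
-- Negation needs only V2 and V3.
module Submission where

open import Defs
open import Level using (Level)
open import Data.Nat using (ℕ; zero; suc; s≤s; z≤n)
open import Data.Product using (_×_; _,_)
open import Algebra.Lattice.Bundles using (BooleanAlgebra)

module BooleanAlgebraOrder {c ℓ : Level} (𝓑 : BooleanAlgebra c ℓ) where
  open BooleanAlgebra 𝓑 renaming (¬_ to ∼_)
  open import Algebra.Lattice.Properties.BooleanAlgebra 𝓑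
  open import Relation.Binary.Reasoning.Setoid setoid

  infix 4 _≤_
  _≤_ : Carrier → Carrier → Set ℓ
  _≤_ = _≤ᴮ_ 𝓑

  ≤-antisym : ∀ {x y} → x ≤ y → y ≤ x → x ≈ y
  ≤-antisym {x} {y} x≤y y≤x = trans (sym x≤y) (trans (∧-comm x y) y≤x)

  x≈⊤⇒x≤y⇒y≈⊤ : ∀ {x y} → x ≈ ⊤ → x ≤ y → y ≈ ⊤
  x≈⊤⇒x≤y⇒y≈⊤ {x} {y} x≈⊤ x≤y = begin
    y      ≈⟨ ∧-identityˡ y ⟨
    ⊤ ∧ y  ≈⟨ ∧-congʳ x≈⊤ ⟨
    x ∧ y  ≈⟨ x≤y ⟩
    x      ≈⟨ x≈⊤ ⟩
    ⊤      ∎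

  y≈⊥⇒x≤y⇒x≈⊥ : ∀ {x y} → y ≈ ⊥ → x ≤ y → x ≈ ⊥
  y≈⊥⇒x≤y⇒x≈⊥ {x} {y} y≈⊥ x≤y = begin
    x      ≈⟨ x≤y ⟨
    x ∧ y  ≈⟨ ∧-congˡ y≈⊥ ⟩
    x ∧ ⊥  ≈⟨ ∧-zeroʳ x ⟩
    ⊥      ∎

  x∧y≈⊤⇒x≈⊤ : ∀ {x y} → x ∧ y ≈ ⊤ → x ≈ ⊤
  x∧y≈⊤⇒x≈⊤ {x} {y} x∧y≈⊤ = begin
    x            ≈⟨ ∨-absorbs-∧ x y ⟨
    x ∨ (x ∧ y)  ≈⟨ ∨-congˡ x∧y≈⊤ ⟩
    x ∨ ⊤        ≈⟨ ∨-zeroʳ x ⟩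
    ⊤            ∎

  x∧y≈⊤⇒y≈⊤ : ∀ {x y} → x ∧ y ≈ ⊤ → y ≈ ⊤
  x∧y≈⊤⇒y≈⊤ {x} {y} x∧y≈⊤ = x∧y≈⊤⇒x≈⊤ (trans (∧-comm y x) x∧y≈⊤)

  ∼x≈⊥⇒x≈⊤ : ∀ {x} → ∼ x ≈ ⊥ → x ≈ ⊤
  ∼x≈⊥⇒x≈⊤ {x} ∼x≈⊥ = begin
    x      ≈⟨ ¬-involutive x ⟨
    ∼ ∼ x  ≈⟨ ¬-cong ∼x≈⊥ ⟩
    ∼ ⊥    ≈⟨ ¬⊥≈⊤ ⟩
    ⊤      ∎

  ∼x≈⊤⇒x≈⊥ : ∀ {x} → ∼ x ≈ ⊤ → x ≈ ⊥
  ∼x≈⊤⇒x≈⊥ {x} ∼x≈⊤ = begin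
    x      ≈⟨ ¬-involutive x ⟨
    ∼ ∼ x  ≈⟨ ¬-cong ∼x≈⊤ ⟩
    ∼ ⊤    ≈⟨ ¬⊤≈⊥ ⟩
    ⊥      ∎

  ∼x≤y⇒x∧y≈⊥⇒y≈∼x : ∀ {x y} → ∼ x ≤ y → x ∧ y ≈ ⊥ → y ≈ ∼ x
  ∼x≤y⇒x∧y≈⊥⇒y≈∼x {x} {y} ∼x≤y x∧y≈⊥ = begin
    y                    ≈⟨ ∧-identityʳ y ⟨
    y ∧ ⊤                ≈⟨ ∧-congˡ (∨-complementʳ x) ⟨
    y ∧ (x ∨ ∼ x)        ≈⟨ ∧-distribˡ-∨ y x (∼ x) ⟩
    (y ∧ x) ∨ (y ∧ ∼ x)  ≈⟨ ∨-cong (trans (∧-comm y x) x∧y≈⊥) (trans (∧-comm y (∼ x)) ∼x≤y) ⟩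
    ⊥ ∨ ∼ x              ≈⟨ ∨-identityˡ (∼ x) ⟩
    ∼ x                  ∎

module ClassicalFormulas {c ℓ : Level} (𝓑 : BooleanAlgebra c ℓ) (m : ℕ) (v : Valuation 𝓑 (suc m)) where
  open BooleanAlgebra 𝓑 renaming (¬_ to ∼_)
  open import Algebra.Lattice.Properties.BooleanAlgebra 𝓑
  open import Relation.Binary.Reasoning.Setoid setoid
  open BooleanAlgebraOrder 𝓑
  open Valuation v

  Classical : Formula → Set ℓ
  Classical γ = b (¬' γ) ≈ ∼ b γ

  Disjoint : Formula → Set ℓ
  Disjoint γ = b γ ∧ b (¬' γ) ≈ ⊥

  disjoint⇒classical : ∀ {γ} → Disjoint γ → Classical γ
  disjoint⇒classical {γ} = ∼x≤y⇒x∧y≈⊥⇒y≈∼x (V2 γ)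

  classical⇒¬°≈⊥ : ∀ {γ} → Classical γ → b (¬' (γ °)) ≈ ⊥
  classical⇒¬°≈⊥ {γ} cγ = trans (V5 γ) (trans (∧-congˡ cγ) (∧-complementʳ (b γ)))

  classical⇒°≈⊤ : ∀ {γ} → Classical γ → b (γ °) ≈ ⊤
  classical⇒°≈⊤ {γ} cγ = ∼x≈⊥⇒x≈⊤ (y≈⊥⇒x≤y⇒x≈⊥ (classical⇒¬°≈⊥ cγ) (V2 (γ °)))

  classical⇒classical° : ∀ {γ} → Classical γ → Classical (γ °)
  classical⇒classical° cγ =
    trans (classical⇒¬°≈⊥ cγ) (sym (trans (¬-cong (classical⇒°≈⊤ cγ)) ¬⊤≈⊥))

  classical⇒classical^ : ∀ {γ} → Classical γ → ∀ k → Classical (γ ^ k)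
  classical⇒classical^ cγ zero    = cγ
  classical⇒classical^ cγ (suc k) = classical⇒classical° (classical⇒classical^ cγ k)

  classical⇒^⁽⁾≈⊤ : ∀ {γ} → Classical γ → ∀ k → b (γ ^⁽ k ⁾) ≈ ⊤
  classical⇒^⁽⁾≈⊤ cγ zero          = classical⇒°≈⊤ cγ
  classical⇒^⁽⁾≈⊤ cγ (suc zero)    = classical⇒°≈⊤ cγ
  classical⇒^⁽⁾≈⊤ {γ} cγ (suc (suc k)) = begin
    b (γ ^⁽ suc (suc k) ⁾)                  ≈⟨ V1∧ _ _ ⟩
    b (γ ^⁽ suc k ⁾) ∧ b (γ ^ suc (suc k))  ≈⟨ ∧-cong (classical⇒^⁽⁾≈⊤ cγ (suc k))
                                                      (classical⇒°≈⊤ (classical⇒classical^ cγ (suc k))) ⟩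
    ⊤ ∧ ⊤                                   ≈⟨ ∧-identityʳ ⊤ ⟩
    ⊤                                       ∎

  ^⁽⁾≈⊤⇒^≈⊤ : ∀ {γ} k → b (γ ^⁽ suc k ⁾) ≈ ⊤ → b (γ ^ suc k) ≈ ⊤
  ^⁽⁾≈⊤⇒^≈⊤ zero    t = t
  ^⁽⁾≈⊤⇒^≈⊤ (suc k) t = x∧y≈⊤⇒y≈⊤ (trans (sym (V1∧ _ _)) t)

  disjoint°⇒disjoint : ∀ {γ} → b (γ °) ≈ ⊤ → Disjoint (γ °) → Disjoint γ
  disjoint°⇒disjoint {γ} t d = begin
    b γ ∧ b (¬' γ)          ≈⟨ V5 γ ⟨
    b (¬' (γ °))            ≈⟨ ∧-identityˡ _ ⟨
    ⊤ ∧ b (¬' (γ °))        ≈⟨ ∧-congʳ t ⟨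
    b (γ °) ∧ b (¬' (γ °))  ≈⟨ d ⟩
    ⊥                       ∎

  ^⁽⁾≈⊤⇒disjoint^⇒disjoint : ∀ {γ} k → b (γ ^⁽ suc k ⁾) ≈ ⊤ → Disjoint (γ ^ k) → Disjoint γ
  ^⁽⁾≈⊤⇒disjoint^⇒disjoint zero    _ d = d
  ^⁽⁾≈⊤⇒disjoint^⇒disjoint (suc k) t d =
    ^⁽⁾≈⊤⇒disjoint^⇒disjoint k t′ (disjoint°⇒disjoint (^⁽⁾≈⊤⇒^≈⊤ k t′) d)
    where t′ = x∧y≈⊤⇒x≈⊤ (trans (sym (V1∧ _ _)) t)

  ^⁽n⁾≈⊤⇒classical : ∀ {γ} → b (γ ^⁽ suc m ⁾) ≈ ⊤ → Classical γ
  ^⁽n⁾≈⊤⇒classical {γ} t = disjoint⇒classical (^⁽⁾≈⊤⇒disjoint^⇒disjoint m t dₘ)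
    where
    dₘ : Disjoint (γ ^ m)
    dₘ = ∼x≈⊤⇒x≈⊥ (trans (sym (V4 γ)) (^⁽⁾≈⊤⇒^≈⊤ m t))

  classical-closed : ∀ {α β γ} → (b (α ^⁽ suc m ⁾) ∧ b (β ^⁽ suc m ⁾)) ≤ b (γ ^⁽ suc m ⁾) →
                     Classical α → Classical β → Classical γ
  classical-closed {α} {β} V6 cα cβ = ^⁽n⁾≈⊤⇒classical (x≈⊤⇒x≤y⇒y≈⊤ αβ≈⊤ V6)
    where
    αβ≈⊤ : b (α ^⁽ suc m ⁾) ∧ b (β ^⁽ suc m ⁾) ≈ ⊤
    αβ≈⊤ = trans (∧-cong (classical⇒^⁽⁾≈⊤ cα (suc m)) (classical⇒^⁽⁾≈⊤ cβ (suc m))) (∧-identityʳ ⊤)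

  classical-¬ : ∀ {α} → Classical α → Classical (¬' α)
  classical-¬ {α} cα = ≤-antisym ¬¬α≤∼¬α (V2 (¬' α))
    where
    ∼¬α≈α : ∼ b (¬' α) ≈ b α
    ∼¬α≈α = trans (¬-cong cα) (¬-involutive (b α))
    ¬¬α≤∼¬α : b (¬' ¬' α) ≤ ∼ b (¬' α)
    ¬¬α≤∼¬α = trans (∧-congˡ ∼¬α≈α) (V3 α)

open import Data.Nat using (_≤_)
open BooleanAlgebra using (_≈_) renaming (¬_ to ∼)
open Valuation using (b)

proposition3p3 : {c ℓ : Level} (𝓑 : BooleanAlgebra c ℓ) → NonTrivial 𝓑 →
    (n : ℕ) → 1 ≤ n → (v : Valuation 𝓑 n) → (α β : Formula) →
    (_≈_ 𝓑 (b v (¬' α)) (∼ 𝓑 (b v α)) → _≈_ 𝓑 (b v (¬' β)) (∼ 𝓑 (b v β)) →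
      (_≈_ 𝓑 (b v (¬' (α ∧' β))) (∼ 𝓑 (b v (α ∧' β))))
      × (_≈_ 𝓑 (b v (¬' (α ∨' β))) (∼ 𝓑 (b v (α ∨' β))))
      × (_≈_ 𝓑 (b v (¬' (α →' β))) (∼ 𝓑 (b v (α →' β)))))
    × (_≈_ 𝓑 (b v (¬' α)) (∼ 𝓑 (b v α)) → _≈_ 𝓑 (b v (¬' ¬' α)) (∼ 𝓑 (b v (¬' α))))
proposition3p3 𝓑 _ (suc m) (s≤s z≤n) v α β =
  (λ cα cβ → classical-closed (V6∧ α β) cα cβ
           , classical-closed (V6∨ α β) cα cβ
           , classical-closed (V6→ α β) cα cβ)
  , classical-¬
  where
  open ClassicalFormulas 𝓑 m v
  open Valuation v using (V6∧; V6∨; V6→)
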